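{- Let $n_0$ be a non-negative integer and, for $i \in \mathbb{Z}^+$, let $n_i = 3n_{i-1}+d_i$ with $d_i \in \{1,2,3\}$. Then $$cpb(K_{n_i}) \leq \Big[ \frac{3}{7}+\frac{1}{63}\Big(\frac{2}{9}\Big)^{i}\Big] n_i^2 + O(n_i).$$
   Context: $K_n$ denotes the complete graph on $n$ vertices. Parallel cleaning process on a finite simple graph $G=(V,E)$ with initial configuration of brushes $\omega_0: V \to \mathbb{N}\cup\{0\}$: set $D_0=V$ (all vertices dirty) and $t=0$. For $v\in V$ let $D_t(v)=|N(v)\cap D_t|$ if $v\in D_t$ and $D_t(v)=0$ otherwise. Let $\rho_{t+1}=\{v\in D_t : \omega_t(v)\ge D_t(v)\}$. If $\rho_{t+1}=\emptyset$, stop with $K=t$; $D_K$ is the final set of dirty vertices and $\omega_K$ the final configuration. Otherwise set $D_{t+1}=D_t\setminus\rho_{t+1}$; for $v\in\rho_{t+1}$ set $\omega_{t+1}(v)=\omega_t(v)-D_t(v)+|N(v)\cap\rho_{t+1}|$; for $u\in D_{t+1}$ set $\omega_{t+1}(u)=\omega_t(u)+|N(u)\cap\rho_{t+1}|$; all other values of $\omega_{t+1}$ equal those of $\omega_t$; then increase $t$ by one and repeat. $G$ can be cleaned by $\omega_0$ if $D_K=\emptyset$. $G$ can be continually cleaned from $\omega_0$ if, setting $\omega_0^0=\omega_0$, for every $s\ge 0$ the graph $G$ can be cleaned by $\omega_0^s$, yielding final configuration $\omega^s_{K_s}$, and $\omega_0^{s+1}=\omega^s_{K_s}$. The continual parallel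 brush number $cpb(G)$ is the minimum total number of brushes $\sum_{v\in V}\omega_0(v)$ over all $\omega_0$ from which $G$ can be continually cleaned. -}

module Defs where

open import Data.Nat using (ℕ; zero; suc; _+_; _*_; _∸_; _≤_; _≤ᵇ_)
open import Data.Bool using (Bool; true; false; _∧_; _∨_; not; if_then_else_; T)
open import Data.Fin using (Fin; zero; suc)
open import Data.Fin.Properties using (_≟_)
open import Data.Product using (_×_; _,_; proj₁; proj₂)
open import Relation.Nullary.Decidable using (⌊_⌋)
open import Relation.Binary.PropositionalEquality using (_≡_)

record SimpleGraph (n : ℕ) : Set where
  field
    adj     : Fin n → Fin n → Bool
    adj-sym : ∀ u v → adj u v ≡ adj v u
    adj-irr : ∀ v → adj v v ≡ false
open SimpleGraph public

K : (n : ℕ) → SimpleGraph n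
K n = record { adj = λ u v → not ⌊ u ≟ v ⌋ ; adj-sym = sym' ; adj-irr = irr }
  where
  open import Relation.Binary.PropositionalEquality using (refl; sym)
  open import Relation.Nullary using (yes; no)
  sym' : ∀ u v → not ⌊ u ≟ v ⌋ ≡ not ⌊ v ≟ u ⌋
  sym' u v with u ≟ v | v ≟ u
  ... | yes _ | yes _ = refl
  ... | no _  | no _  = refl
  ... | yes p | no q  = Data.Empty.⊥-elim (q (sym p)) where import Data.Empty
  ... | no p  | yes q = Data.Empty.⊥-elim (p (sym q)) where import Data.Empty
  irr : ∀ v → not ⌊ v ≟ v ⌋ ≡ false
  irr v with v ≟ v
  ... | yes _ = refl
  ... | no ¬p = Data.Empty.⊥-elim (¬p refl) where import Data.Empty

sumFin : ∀ {n} → (Fin n → ℕ) → ℕ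
sumFin {zero}  f = 0
sumFin {suc n} f = f zero + sumFin (λ i → f (suc i))

count : ∀ {n} → (Fin n → Bool) → ℕ
count S = sumFin (λ i → if S i then 1 else 0)

anyFin : ∀ {n} → (Fin n → Bool) → Bool
anyFin {zero}  S = false
anyFin {suc n} S = S zero ∨ anyFin (λ i → S (suc i))

Config : ℕ → Set
Config n = Fin n → ℕ

DirtySet : ℕ → Set
DirtySet n = Fin n → Bool

module _ {n : ℕ} (G : SimpleGraph n) where

  nbrsIn : DirtySet n → Fin n → ℕ
  nbrsIn S v = count (λ u → adj G v u ∧ S u)

  dirtyDeg : DirtySet n → Fin n → ℕ
  dirtyDeg D v = if D v then nbrsIn D v else 0

  firing : Config n → DirtySet n → DirtySet n
  firing ω D v = D v ∧ (dirtyDeg D v ≤ᵇ ω v)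

  stepState : Config n → DirtySet n → Config n × DirtySet n
  stepState ω D = ω' , D'
    where
    ρ  = firing ω D
    D' = λ v → D v ∧ not (ρ v)
    ω' : Config n
    ω' v = if ρ v then ω v ∸ dirtyDeg D v + nbrsIn ρ v
           else (if D' v then ω v + nbrsIn ρ v else ω v)

  runFuel : ℕ → Config n → DirtySet n → Config n × DirtySet n
  runFuel zero    ω D = ω , D
  runFuel (suc k) ω D =
    if anyFin (firing ω D)
    then runFuel k (proj₁ (stepState ω D)) (proj₂ (stepState ω D))
    else (ω , D)

  -- Each non-terminal round removes at least one dirty vertex, so after n
  -- rounds the process has stopped (once D = ∅, ρ = ∅). Hence n rounds of fuel
  -- compute the final state (ω_K , D_K) starting from D_0 = V.
  finalState : Config n → Config n × DirtySet n
  finalState ω₀ = runFuel n ω₀ (λ _ → true)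

  finalConfig : Config n → Config n
  finalConfig ω₀ = proj₁ (finalState ω₀)

  Cleans : Config n → Set
  Cleans ω₀ = ∀ v → proj₂ (finalState ω₀) v ≡ false

  iterConfig : ℕ → Config n → Config n
  iterConfig zero    ω = ω
  iterConfig (suc s) ω = finalConfig (iterConfig s ω)

  ContinuallyCleans : Config n → Set
  ContinuallyCleans ω₀ = ∀ s → Cleans (iterConfig s ω₀)

totalBrushes : ∀ {n} → Config n → ℕ
totalBrushes = sumFin

-- The sequence n_i : n_0 given, n_{i+1} = 3 n_i + d (i), where d i plays the
-- role of the paper's d_{i+1}.
nSeq : ℕ → (ℕ → ℕ) → ℕ → ℕ
nSeq n₀ d zero    = n₀
nSeq n₀ d (suc i) = 3 * nSeq n₀ d i + d i

module Submission where

open import Defs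
open import Data.Nat using (ℕ; zero; suc; _+_; _*_; _^_; _≤_; _<_; _∸_; _≤ᵇ_; z≤n; s≤s)
open import Data.Nat.Properties hiding (_≟_)
open import Data.Nat.Tactic.RingSolver using (solve-∀)
open import Data.Bool using (Bool; true; false; _∧_; not; if_then_else_)
open import Data.Fin using (Fin; zero; suc; _↑ˡ_; _↑ʳ_; splitAt; join)
open import Data.Fin.Properties using (_≟_; splitAt-↑ˡ; splitAt-↑ʳ; join-splitAt)
open import Data.Product using (Σ; ∃; _×_; _,_; proj₁; proj₂)
open import Data.Sum using (_⊎_; inj₁; inj₂; [_,_]′)
open import Data.Unit using (⊤; tt)
open import Function using (_∘_; _$_)
open import Relation.Nullary using (yes; no; contradiction)
open import Relation.Nullary.Reflects using (ofʸ; ofⁿ)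
open import Relation.Binary.PropositionalEquality

-- Split K_n, n = 3a + d, into blocks L, M, R of sizes a, c + 1 = a + d and a. Put X + (c + 1 + a)
-- brushes on L, c on M and Y on R, where X and Y belong to an invariant family of configurations that
-- continually clean K_a and have fewer than a brushes per vertex. The extra c + 1 + a brushes on a
-- vertex of L pay exactly for its dirty neighbours in M ∪ R, so L replays the cleaning of K_a from X
-- while M and R wait; then M fires as a whole, and finally R. The result has the same shape with L and R
-- exchanged and X replaced by the final configuration of K_a, hence the cleaning goes on forever.
-- The cost obeys T(3a + d) = 2 T(a) + a (a + c + 1) + (c + 1) c, which unfolds to the stated bound.

indicator : Bool → ℕ
indicator b = if b then 1 else 0

sumFin-cong : ∀ {n} {f g : Fin n → ℕ} → (∀ i → f i ≡ g i) → sumFin f ≡ sumFin g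
sumFin-cong {zero}  f≗g = refl
sumFin-cong {suc n} f≗g = cong₂ _+_ (f≗g zero) (sumFin-cong (f≗g ∘ suc))

sumFin-+ : ∀ {n} (f g : Fin n → ℕ) → sumFin (λ i → f i + g i) ≡ sumFin f + sumFin g
sumFin-+ {zero}  f g = refl
sumFin-+ {suc n} f g = begin
  f zero + g zero + sumFin (λ i → f (suc i) + g (suc i))
    ≡⟨ cong (f zero + g zero +_) (sumFin-+ (f ∘ suc) (g ∘ suc)) ⟩
  f zero + g zero + (sumFin (f ∘ suc) + sumFin (g ∘ suc))
    ≡⟨ interchange (f zero) (g zero) _ _ ⟩
  f zero + sumFin (f ∘ suc) + (g zero + sumFin (g ∘ suc)) ∎
  where
  open ≡-Reasoning
  interchange : ∀ a b c d → a + b + (c + d) ≡ a + c + (b + d)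
  interchange = solve-∀

sumFin-const : ∀ n c → sumFin {n} (λ _ → c) ≡ n * c
sumFin-const zero    c = refl
sumFin-const (suc n) c = cong (c +_) (sumFin-const n c)

sumFin-↑ : ∀ p q (f : Fin (p + q) → ℕ) →
  sumFin f ≡ sumFin (λ i → f (i ↑ˡ q)) + sumFin (λ j → f (p ↑ʳ j))
sumFin-↑ zero    q f = refl
sumFin-↑ (suc p) q f =
  trans (cong (f zero +_) (sumFin-↑ p q (f ∘ suc))) (sym (+-assoc (f zero) _ _))

count-true : ∀ {n} {S : Fin n → Bool} → (∀ i → S i ≡ true) → count S ≡ n
count-true {n} S≡true =
  trans (sumFin-cong (cong indicator ∘ S≡true)) (trans (sumFin-const n 1) (*-identityʳ n))

count-false : ∀ {n} {S : Fin n → Bool} → (∀ i → S i ≡ false) → count S ≡ 0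
count-false {n} S≡false =
  trans (sumFin-cong (cong indicator ∘ S≡false)) (trans (sumFin-const n 0) (*-zeroʳ n))

count-pos : ∀ {n} (S : Fin n → Bool) {v} → S v ≡ true → 1 ≤ count S
count-pos S {zero}  Sv≡true rewrite Sv≡true = s≤s z≤n
count-pos S {suc v} Sv≡true =
  ≤-trans (count-pos (S ∘ suc) Sv≡true) (m≤n+m _ (indicator (S zero)))

count-zero : ∀ {n} (S : Fin n → Bool) → count S ≡ 0 → ∀ v → S v ≡ false
count-zero S count≡0 v with S v in Sv≡
... | false = refl
... | true  = contradiction (subst (1 ≤_) count≡0 (count-pos S Sv≡)) λ ()

count-∖ : ∀ {n} (D ρ : Fin n → Bool) → (∀ v → ρ v ≡ true → D v ≡ true) →
  count (λ v → D v ∧ not (ρ v)) + count ρ ≡ count D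
count-∖ D ρ ρ⊆D =
  trans (sym (sumFin-+ (indicator ∘ (λ v → D v ∧ not (ρ v))) (indicator ∘ ρ)))
        (sumFin-cong pointwise)
  where
  pointwise : ∀ v → indicator (D v ∧ not (ρ v)) + indicator (ρ v) ≡ indicator (D v)
  pointwise v with ρ v in ρv≡
  ... | true rewrite ρ⊆D v ρv≡ = refl
  ... | false with D v
  ...   | true  = refl
  ...   | false = refl

anyFin-intro : ∀ {n} (S : Fin n → Bool) {v} → S v ≡ true → anyFin S ≡ true
anyFin-intro S {zero} Sv≡true rewrite Sv≡true = refl
anyFin-intro S {suc v} Sv≡true with S zero
... | true  = refl
... | false = anyFin-intro (S ∘ suc) Sv≡true

anyFin-elim : ∀ {n} (S : Fin n → Bool) → anyFin S ≡ true → ∃ λ v → S v ≡ true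
anyFin-elim {suc n} S any≡true with S zero in S0≡
... | true  = zero , S0≡
... | false = let v , Sv≡true = anyFin-elim (S ∘ suc) any≡true in suc v , Sv≡true

anyFin-false : ∀ {n} (S : Fin n → Bool) → anyFin S ≡ false → ∀ v → S v ≡ false
anyFin-false S any≡false v with S v in Sv≡
... | false = refl
... | true  = contradiction (trans (sym (anyFin-intro S Sv≡)) any≡false) λ ()

anyFin-none : ∀ {n} (S : Fin n → Bool) → (∀ v → S v ≡ false) → anyFin S ≡ false
anyFin-none {zero}  S S≡false = refl
anyFin-none {suc n} S S≡false rewrite S≡false zero = anyFin-none (S ∘ suc) (S≡false ∘ suc)

≤ᵇ-true : ∀ {m n} → m ≤ n → (m ≤ᵇ n) ≡ true
≤ᵇ-true {m} {n} m≤n with m ≤ᵇ n | ≤ᵇ-reflects-≤ m n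
... | true  | _       = refl
... | false | ofⁿ m≰n = contradiction m≤n m≰n

≤ᵇ-false : ∀ {m n} → n < m → (m ≤ᵇ n) ≡ false
≤ᵇ-false {m} {n} n<m with m ≤ᵇ n | ≤ᵇ-reflects-≤ m n
... | false | _       = refl
... | true  | ofʸ m≤n = contradiction m≤n (<⇒≱ n<m)

suc-≤ᵇ-suc : ∀ m n → (suc m ≤ᵇ suc n) ≡ (m ≤ᵇ n)
suc-≤ᵇ-suc zero    n = refl
suc-≤ᵇ-suc (suc m) n = refl

+-cancelˡ-≤ᵇ : ∀ k m n → (k + m ≤ᵇ k + n) ≡ (m ≤ᵇ n)
+-cancelˡ-≤ᵇ zero    m n = refl
+-cancelˡ-≤ᵇ (suc k) m n = trans (suc-≤ᵇ-suc (k + m) (k + n)) (+-cancelˡ-≤ᵇ k m n)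

adj-K-suc : ∀ {n} (v u : Fin n) → adj (K (suc n)) (suc v) (suc u) ≡ adj (K n) v u
adj-K-suc v u with v ≟ u
... | yes _ = refl
... | no  _ = refl

nbrsIn-K : ∀ {n} (S : DirtySet n) (v : Fin n) → nbrsIn (K n) S v + indicator (S v) ≡ count S
nbrsIn-K {suc n} S zero    = +-comm (count (S ∘ suc)) (indicator (S zero))
nbrsIn-K {suc n} S (suc v) = begin
  indicator (S zero) + count (λ u → adj (K (suc n)) (suc v) (suc u) ∧ S (suc u))
    + indicator (S (suc v))
    ≡⟨ +-assoc (indicator (S zero)) _ _ ⟩
  indicator (S zero) + (count (λ u → adj (K (suc n)) (suc v) (suc u) ∧ S (suc u))
    + indicator (S (suc v)))
    ≡⟨ cong (λ m → indicator (S zero) + (m + indicator (S (suc v))))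
            (sumFin-cong λ u → cong (λ b → indicator (b ∧ S (suc u))) (adj-K-suc v u)) ⟩
  indicator (S zero) + (nbrsIn (K n) (S ∘ suc) v + indicator (S (suc v)))
    ≡⟨ cong (indicator (S zero) +_) (nbrsIn-K (S ∘ suc) v) ⟩
  count S ∎
  where open ≡-Reasoning

nbrsIn-K-∈ : ∀ {n} (S : DirtySet n) {v} → S v ≡ true → suc (nbrsIn (K n) S v) ≡ count S
nbrsIn-K-∈ S {v} Sv≡true =
  trans (+-comm 1 _)
        (trans (cong (λ b → nbrsIn (K _) S v + indicator b) (sym Sv≡true)) (nbrsIn-K S v))

nbrsIn-K-∉ : ∀ {n} (S : DirtySet n) {v} → S v ≡ false → nbrsIn (K n) S v ≡ count S
nbrsIn-K-∉ S {v} Sv≡false =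
  trans (sym (+-identityʳ _))
        (trans (cong (λ b → nbrsIn (K _) S v + indicator b) (sym Sv≡false)) (nbrsIn-K S v))

module Round {n : ℕ} (G : SimpleGraph n) (ω : Config n) (D : DirtySet n) where

  ρ : DirtySet n
  ρ = firing G ω D

  ω′ : Config n
  ω′ = proj₁ (stepState G ω D)

  D′ : DirtySet n
  D′ = proj₂ (stepState G ω D)

  firing-clean : ∀ {v} → D v ≡ false → ρ v ≡ false
  firing-clean Dv≡false rewrite Dv≡false = refl

  firing-dirty : ∀ {v} → D v ≡ true → ρ v ≡ (nbrsIn G D v ≤ᵇ ω v)
  firing-dirty Dv≡true rewrite Dv≡true = refl

  firing⊆dirty : ∀ v → ρ v ≡ true → D v ≡ true
  firing⊆dirty v ρv≡true with D v
  ... | true  = refl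
  ... | false = ρv≡true

  brushes-clean : ∀ {v} → D v ≡ false → ω′ v ≡ ω v
  brushes-clean {v} Dv≡false rewrite firing-clean Dv≡false | Dv≡false = refl

  brushes-waiting : ∀ {v} → D v ≡ true → ρ v ≡ false → ω′ v ≡ ω v + nbrsIn G ρ v
  brushes-waiting Dv≡true ρv≡false rewrite ρv≡false | Dv≡true = refl

  brushes-fired : ∀ {v} → ρ v ≡ true → ω′ v ≡ ω v ∸ nbrsIn G D v + nbrsIn G ρ v
  brushes-fired {v} ρv≡true rewrite ρv≡true | firing⊆dirty v ρv≡true = refl

  count-D′ : count D′ + count ρ ≡ count D
  count-D′ = count-∖ D ρ firing⊆dirty

  count-D′< : anyFin ρ ≡ true → count D′ < count D
  count-D′< any≡true = begin-strict
    count D′             <⟨ m<m+n (count D′) (count-pos ρ (proj₂ (anyFin-elim ρ any≡true))) ⟩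
    count D′ + count ρ   ≡⟨ count-D′ ⟩
    count D              ∎
    where open ≤-Reasoning

allDirty : ∀ {n} → DirtySet n
allDirty _ = true

module _ {n : ℕ} (G : SimpleGraph n) where

  data Halts (P : Config n → DirtySet n → Set) (ω : Config n) (D : DirtySet n) : Set where
    halt : anyFin (firing G ω D) ≡ false → P ω D → Halts P ω D
    next : anyFin (firing G ω D) ≡ true →
           Halts P (Round.ω′ G ω D) (Round.D′ G ω D) → Halts P ω D

  Halts-map : ∀ {P Q : Config n → DirtySet n → Set} {ω D} →
    (∀ {ω D} → P ω D → Q ω D) → Halts P ω D → Halts Q ω D
  Halts-map P⇒Q (halt stop p) = halt stop (P⇒Q p)
  Halts-map P⇒Q (next go h)   = next go (Halts-map P⇒Q h)

  halt-clean : ∀ {P ω D} → (∀ v → D v ≡ false) → P ω D → Halts P ω D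
  halt-clean {ω = ω} {D} D≡false = halt (anyFin-none _ (Round.firing-clean G ω D ∘ D≡false))

  Halts⇒runFuel : ∀ {P ω D} → Halts P ω D → ∀ k → count D ≤ k →
    P (proj₁ (runFuel G k ω D)) (proj₂ (runFuel G k ω D))
  Halts⇒runFuel (halt _ p)    zero    _ = p
  Halts⇒runFuel (halt stop p) (suc k) _ rewrite stop = p
  Halts⇒runFuel {ω = ω} {D} (next go _) zero count≤0 =
    contradiction (≤-trans (Round.count-D′< G ω D go) count≤0) λ ()
  Halts⇒runFuel {ω = ω} {D} (next go h) (suc k) count≤k rewrite go =
    Halts⇒runFuel h k (≤-pred (≤-trans (Round.count-D′< G ω D go) count≤k))

  ReachesRun : ℕ → Config n → DirtySet n → Config n → DirtySet n → Set
  ReachesRun k ω D ω′ D′ =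
    (∀ v → ω′ v ≡ proj₁ (runFuel G k ω D) v) × (∀ v → D′ v ≡ proj₂ (runFuel G k ω D) v)

  runFuel-Halts : ∀ k ω D → count D ≤ k → Halts (ReachesRun k ω D) ω D
  runFuel-Halts zero ω D count≤0 =
    halt (anyFin-none _ (λ v → Round.firing-clean G ω D (count-zero D (n≤0⇒n≡0 count≤0) v)))
         ((λ _ → refl) , (λ _ → refl))
  runFuel-Halts (suc k) ω D count≤k with anyFin (firing G ω D) in any≡
  ... | true  = next any≡
    (runFuel-Halts k _ _ (≤-pred (≤-trans (Round.count-D′< G ω D any≡) count≤k)))
  ... | false = halt any≡ ((λ _ → refl) , (λ _ → refl))

  Halts⇒final : ∀ {P ω₀} → Halts P ω₀ allDirty → P (finalConfig G ω₀) (proj₂ (finalState G ω₀))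
  Halts⇒final h = Halts⇒runFuel h n (≤-reflexive (count-true λ _ → refl))

  final-Halts : ∀ ω₀ → Halts (ReachesRun n ω₀ allDirty) ω₀ allDirty
  final-Halts ω₀ = runFuel-Halts n ω₀ allDirty (≤-reflexive (count-true λ _ → refl))

record Blocks (n a b : ℕ) : Set where
  field
    left   : Fin a → Fin n
    middle : Fin b → Fin n
    right  : Fin a → Fin n
    sumFin-blocks : ∀ (f : Fin n → ℕ) →
      sumFin f ≡ sumFin (f ∘ left) + (sumFin (f ∘ middle) + sumFin (f ∘ right))
    blocks-cover : ∀ v → (∃ λ i → left i ≡ v) ⊎ ((∃ λ j → middle j ≡ v) ⊎ (∃ λ k → right k ≡ v))
    glue : (Fin a → ℕ) → (Fin b → ℕ) → (Fin a → ℕ) → Config n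
    glue-left   : ∀ f g h i → glue f g h (left i) ≡ f i
    glue-middle : ∀ f g h j → glue f g h (middle j) ≡ g j
    glue-right  : ∀ f g h k → glue f g h (right k) ≡ h k

  blocks-elim : ∀ (P : Fin n → Set) → (∀ i → P (left i)) → (∀ j → P (middle j)) →
    (∀ k → P (right k)) → ∀ v → P v
  blocks-elim P pl pm pr v with blocks-cover v
  ... | inj₁ (i , refl)        = pl i
  ... | inj₂ (inj₁ (j , refl)) = pm j
  ... | inj₂ (inj₂ (k , refl)) = pr k

  count-blocks : (S : DirtySet n) →
    count S ≡ count (S ∘ left) + (count (S ∘ middle) + count (S ∘ right))
  count-blocks S = sumFin-blocks (indicator ∘ S)

  size : n ≡ a + (b + a)
  size = begin
    n                                           ≡⟨ sym (count-true {S = allDirty} λ _ → refl) ⟩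
    count {n} allDirty                          ≡⟨ count-blocks allDirty ⟩
    count {a} allDirty + (count {b} allDirty + count {a} allDirty)
      ≡⟨ cong₂ _+_ (all a) (cong₂ _+_ (all b) (all a)) ⟩
    a + (b + a)                                 ∎
    where
    open ≡-Reasoning
    all : ∀ m → count {m} allDirty ≡ m
    all m = count-true λ _ → refl

mirror : ∀ {n a b} → Blocks n a b → Blocks n a b
mirror {n} {a} {b} B = record
  { left   = right
  ; middle = middle
  ; right  = left
  ; sumFin-blocks = λ f → trans (sumFin-blocks f)
                        (reverse₃ (sumFin (f ∘ left)) (sumFin (f ∘ middle)) (sumFin (f ∘ right)))
  ; blocks-cover  = λ v → [ inj₂ ∘ inj₂ , [ inj₂ ∘ inj₁ , inj₁ ]′ ]′ (blocks-cover v)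
  ; glue        = λ f g h → glue h g f
  ; glue-left   = λ f g h → glue-right h g f
  ; glue-middle = λ f g h → glue-middle h g f
  ; glue-right  = λ f g h → glue-left h g f
  }
  where
  open Blocks B
  reverse₃ : ∀ x y z → x + (y + z) ≡ z + (y + x)
  reverse₃ = solve-∀

standardBlocks : ∀ a b → Blocks (a + (b + a)) a b
standardBlocks a b = record
  { left   = _↑ˡ (b + a)
  ; middle = λ j → a ↑ʳ (j ↑ˡ a)
  ; right  = λ k → a ↑ʳ (b ↑ʳ k)
  ; sumFin-blocks = λ f →
      trans (sumFin-↑ a (b + a) f) (cong (sumFin {a} (f ∘ (_↑ˡ (b + a))) +_) (sumFin-↑ b a (f ∘ (a ↑ʳ_))))
  ; blocks-cover = elim (λ v → (∃ λ i → i ↑ˡ (b + a) ≡ v) ⊎ ((∃ λ j → a ↑ʳ (j ↑ˡ a) ≡ v) ⊎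
                                                             (∃ λ k → a ↑ʳ (b ↑ʳ k) ≡ v)))
                       (λ i → inj₁ (i , refl)) (λ j → inj₂ (inj₁ (j , refl))) (λ k → inj₂ (inj₂ (k , refl)))
  ; glue        = glue
  ; glue-left   = λ f g h i → cong [ f , [ g , h ]′ ∘ splitAt b ]′ (splitAt-↑ˡ a i (b + a))
  ; glue-middle = λ f g h j → trans (cong [ f , [ g , h ]′ ∘ splitAt b ]′ (splitAt-↑ʳ a (b + a) (j ↑ˡ a)))
                                    (cong [ g , h ]′ (splitAt-↑ˡ b j a))
  ; glue-right  = λ f g h k → trans (cong [ f , [ g , h ]′ ∘ splitAt b ]′ (splitAt-↑ʳ a (b + a) (b ↑ʳ k)))
                                    (cong [ g , h ]′ (splitAt-↑ʳ b a k))
  }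
  where
  glue : (Fin a → ℕ) → (Fin b → ℕ) → (Fin a → ℕ) → Fin (a + (b + a)) → ℕ
  glue f g h v = [ f , [ g , h ]′ ∘ splitAt b ]′ (splitAt a v)
  elim : ∀ (P : Fin (a + (b + a)) → Set) → (∀ i → P (i ↑ˡ (b + a))) → (∀ j → P (a ↑ʳ (j ↑ˡ a))) →
    (∀ k → P (a ↑ʳ (b ↑ʳ k))) → ∀ v → P v
  elim P pl pm pr v = subst P (join-splitAt a (b + a) v) (outer (splitAt a v))
    where
    inner : ∀ s → P (a ↑ʳ join b a s)
    inner (inj₁ j) = pm j
    inner (inj₂ k) = pr k
    outer : ∀ s → P (join a (b + a) s)
    outer (inj₁ i) = pl i
    outer (inj₂ w) = subst (P ∘ (a ↑ʳ_)) (join-splitAt b a w) (inner (splitAt b w))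

blocksOf : ∀ {n} a b → n ≡ a + (b + a) → Blocks n a b
blocksOf a b n≡ = subst (λ m → Blocks m a b) (sym n≡) (standardBlocks a b)

record Scheme (n : ℕ) : Set₁ where
  field
    Inv        : Config n → Set
    Inv⇒Cleans : ∀ {ω} → Inv ω → Cleans (K n) ω
    Inv-final  : ∀ {ω} → Inv ω → Inv (finalConfig (K n) ω)
    -- keeps a copy of such a configuration in the right block of a larger graph from firing too early
    Inv⇒<      : ∀ {ω} → Inv ω → ∀ v → ω v < n
    start      : Config n
    start-Inv  : Inv start

  Inv-iter : ∀ s {ω} → Inv ω → Inv (iterConfig (K n) s ω)
  Inv-iter zero    inv = inv
  Inv-iter (suc s) inv = Inv-final (Inv-iter s inv)

  start-continually : ContinuallyCleans (K n) start
  start-continually s = Inv⇒Cleans (Inv-iter s start-Inv)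

scheme₀ : Scheme 0
scheme₀ = record
  { Inv = λ _ → ⊤ ; Inv⇒Cleans = λ _ () ; Inv-final = λ _ → tt ; Inv⇒< = λ _ ()
  ; start = λ () ; start-Inv = tt }

module Tripling {a c : ℕ} (a≤c : a ≤ c) (S : Scheme a) {n : ℕ} where

  base : ℕ
  base = suc c + a

  module Cleaning (B : Blocks n a (suc c)) (Y : Config a) (Y<c : ∀ k → Y k < c) where
    open Blocks B

    record Mirrors (ω : Config n) (D : DirtySet n) (x : Config a) (E : DirtySet a) : Set where
      field
        dirty-left     : ∀ i → D (left i) ≡ E i
        brushes-left   : ∀ i → ω (left i) ≡ (if E i then base else 0) + x i
        dirty-middle   : ∀ j → D (middle j) ≡ true
        brushes-middle : ∀ j → ω (middle j) + count E ≡ c + a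
        dirty-right    : ∀ k → D (right k) ≡ true
        brushes-right  : ∀ k → ω (right k) + count E ≡ Y k + a

      brushes-left-clean : ∀ {i} → E i ≡ false → ω (left i) ≡ x i
      brushes-left-clean {i} Ei = trans (brushes-left i) (cong (λ b → (if b then base else 0) + x i) Ei)

      brushes-left-dirty : ∀ {i} → E i ≡ true → ω (left i) ≡ base + x i
      brushes-left-dirty {i} Ei = trans (brushes-left i) (cong (λ b → (if b then base else 0) + x i) Ei)

      count-D : count D ≡ count E + base
      count-D = begin
        count D
          ≡⟨ count-blocks D ⟩
        count (D ∘ left) + (count (D ∘ middle) + count (D ∘ right))
          ≡⟨ cong₂ _+_ (sumFin-cong (cong indicator ∘ dirty-left))
                       (cong₂ _+_ (count-true dirty-middle) (count-true dirty-right)) ⟩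
        count E + base ∎
        where open ≡-Reasoning

    module MirrorStep {ω : Config n} {D : DirtySet n} {x : Config a} {E : DirtySet a}
                (r : Mirrors ω D x E) (go : anyFin (firing (K a) x E) ≡ true) where
      open Mirrors r
      module Big   = Round (K n) ω D
      module Small = Round (K a) x E

      count-E-pos : 1 ≤ count E
      count-E-pos = let i , ρi = anyFin-elim Small.ρ go in count-pos E (Small.firing⊆dirty i ρi)

      nbrs-left : ∀ {i} → E i ≡ true → nbrsIn (K n) D (left i) ≡ base + nbrsIn (K a) E i
      nbrs-left {i} Ei = suc-injective (begin
        suc (nbrsIn (K n) D (left i))  ≡⟨ nbrsIn-K-∈ D (trans (dirty-left i) Ei) ⟩
        count D                        ≡⟨ count-D ⟩
        count E + base                 ≡⟨ cong (_+ base) (sym (nbrsIn-K-∈ E Ei)) ⟩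
        suc (nbrsIn (K a) E i) + base  ≡⟨ +-comm (suc _) base ⟩
        base + suc (nbrsIn (K a) E i)  ≡⟨ +-suc base _ ⟩
        suc (base + nbrsIn (K a) E i)  ∎)
        where open ≡-Reasoning

      firing-left : ∀ i → Big.ρ (left i) ≡ Small.ρ i
      firing-left i = by-cases (E i) refl
        where
        open ≡-Reasoning
        by-cases : ∀ b → E i ≡ b → Big.ρ (left i) ≡ Small.ρ i
        by-cases false Ei = trans (Big.firing-clean (trans (dirty-left i) Ei)) (sym (Small.firing-clean Ei))
        by-cases true  Ei = begin
          Big.ρ (left i)                           ≡⟨ Big.firing-dirty (trans (dirty-left i) Ei) ⟩
          (nbrsIn (K n) D (left i) ≤ᵇ ω (left i))  ≡⟨ cong₂ _≤ᵇ_ (nbrs-left Ei) (brushes-left-dirty Ei) ⟩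
          (base + nbrsIn (K a) E i ≤ᵇ base + x i)  ≡⟨ +-cancelˡ-≤ᵇ base _ _ ⟩
          (nbrsIn (K a) E i ≤ᵇ x i)                ≡⟨ sym (Small.firing-dirty Ei) ⟩
          Small.ρ i                                ∎

      -- A middle or right vertex holds fewer than base brushes, while it has at least base dirty neighbours.
      idle : ∀ {v m} → D v ≡ true → ω v + count E ≡ m → m < base → Big.ρ v ≡ false
      idle {v} {m} Dv ωv m<base = trans (Big.firing-dirty Dv) (≤ᵇ-false (begin-strict
        ω v                  ≤⟨ m≤m+n (ω v) (count E) ⟩
        ω v + count E        ≡⟨ ωv ⟩
        m                    <⟨ m<base ⟩
        base                 ≤⟨ ≤-pred base<N ⟩
        nbrsIn (K n) D v     ∎))
        where
        open ≤-Reasoning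
        base<N : suc base ≤ suc (nbrsIn (K n) D v)
        base<N = begin
          1 + base                   ≤⟨ +-monoˡ-≤ base count-E-pos ⟩
          count E + base             ≡⟨ sym count-D ⟩
          count D                    ≡⟨ sym (nbrsIn-K-∈ D Dv) ⟩
          suc (nbrsIn (K n) D v)     ∎

      idle-middle : ∀ j → Big.ρ (middle j) ≡ false
      idle-middle j = idle (dirty-middle j) (brushes-middle j) ≤-refl

      idle-right : ∀ k → Big.ρ (right k) ≡ false
      idle-right k = idle (dirty-right k) (brushes-right k) (s≤s (+-monoˡ-≤ a (<⇒≤ (Y<c k))))

      count-fired : count Big.ρ ≡ count Small.ρ
      count-fired = begin
        count Big.ρ
          ≡⟨ count-blocks Big.ρ ⟩
        count (Big.ρ ∘ left) + (count (Big.ρ ∘ middle) + count (Big.ρ ∘ right))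
          ≡⟨ cong₂ _+_ (sumFin-cong (cong indicator ∘ firing-left))
                       (cong₂ _+_ (count-false idle-middle) (count-false idle-right)) ⟩
        count Small.ρ + 0
          ≡⟨ +-identityʳ _ ⟩
        count Small.ρ ∎
        where open ≡-Reasoning

      big-go : anyFin Big.ρ ≡ true
      big-go = let i , ρi = anyFin-elim Small.ρ go in anyFin-intro Big.ρ (trans (firing-left i) ρi)

      nbrs-fired-left : ∀ i → nbrsIn (K n) Big.ρ (left i) ≡ nbrsIn (K a) Small.ρ i
      nbrs-fired-left i = +-cancelʳ-≡ (indicator (Small.ρ i)) _ _ (begin
        nbrsIn (K n) Big.ρ (left i) + indicator (Small.ρ i)
          ≡⟨ cong (λ b → nbrsIn (K n) Big.ρ (left i) + indicator b) (sym (firing-left i)) ⟩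
        nbrsIn (K n) Big.ρ (left i) + indicator (Big.ρ (left i))
          ≡⟨ nbrsIn-K Big.ρ (left i) ⟩
        count Big.ρ
          ≡⟨ count-fired ⟩
        count Small.ρ
          ≡⟨ sym (nbrsIn-K Small.ρ i) ⟩
        nbrsIn (K a) Small.ρ i + indicator (Small.ρ i) ∎)
        where open ≡-Reasoning

      next-brushes-idle : ∀ {v m} → D v ≡ true → Big.ρ v ≡ false → ω v + count E ≡ m →
        Big.ω′ v + count Small.D′ ≡ m
      next-brushes-idle {v} {m} Dv ρv ωv = begin
        Big.ω′ v + count Small.D′
          ≡⟨ cong (_+ count Small.D′) (Big.brushes-waiting Dv ρv) ⟩
        ω v + nbrsIn (K n) Big.ρ v + count Small.D′
          ≡⟨ cong (λ l → ω v + l + count Small.D′) (trans (nbrsIn-K-∉ Big.ρ ρv) count-fired) ⟩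
        ω v + count Small.ρ + count Small.D′
          ≡⟨ +-assoc (ω v) _ _ ⟩
        ω v + (count Small.ρ + count Small.D′)
          ≡⟨ cong (ω v +_) (trans (+-comm (count Small.ρ) _) Small.count-D′) ⟩
        ω v + count E
          ≡⟨ ωv ⟩
        m ∎
        where open ≡-Reasoning

      next-brushes-left : ∀ i → Big.ω′ (left i) ≡ (if Small.D′ i then base else 0) + Small.ω′ i
      next-brushes-left i = by-cases (E i) (Small.ρ i) refl refl
        where
        open ≡-Reasoning
        Di : ∀ {e} → E i ≡ e → D (left i) ≡ e
        Di Ei = trans (dirty-left i) Ei
        D′i : ∀ {e f} → E i ≡ e → Small.ρ i ≡ f → Small.D′ i ≡ e ∧ not f
        D′i = cong₂ (λ e f → e ∧ not f)
        shift : ∀ {d} → Small.D′ i ≡ d → Big.ω′ (left i) ≡ (if d then base else 0) + Small.ω′ i →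
          Big.ω′ (left i) ≡ (if Small.D′ i then base else 0) + Small.ω′ i
        shift D′≡d eq = trans eq (cong (λ d → (if d then base else 0) + Small.ω′ i) (sym D′≡d))
        by-cases : ∀ e f → E i ≡ e → Small.ρ i ≡ f →
          Big.ω′ (left i) ≡ (if Small.D′ i then base else 0) + Small.ω′ i
        by-cases false f Ei ρi = shift (D′i Ei ρi) $ begin
          Big.ω′ (left i)   ≡⟨ Big.brushes-clean (Di Ei) ⟩
          ω (left i)        ≡⟨ brushes-left-clean Ei ⟩
          x i               ≡⟨ sym (Small.brushes-clean Ei) ⟩
          Small.ω′ i        ∎
        by-cases true false Ei ρi = shift (D′i Ei ρi) $ begin
          Big.ω′ (left i)
            ≡⟨ Big.brushes-waiting (Di Ei) (trans (firing-left i) ρi) ⟩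
          ω (left i) + nbrsIn (K n) Big.ρ (left i)
            ≡⟨ cong₂ _+_ (brushes-left-dirty Ei) (nbrs-fired-left i) ⟩
          base + x i + nbrsIn (K a) Small.ρ i
            ≡⟨ +-assoc base (x i) _ ⟩
          base + (x i + nbrsIn (K a) Small.ρ i)
            ≡⟨ cong (base +_) (sym (Small.brushes-waiting Ei ρi)) ⟩
          base + Small.ω′ i ∎
        by-cases true true Ei ρi = shift (D′i Ei ρi) $ begin
          Big.ω′ (left i)
            ≡⟨ Big.brushes-fired (trans (firing-left i) ρi) ⟩
          ω (left i) ∸ nbrsIn (K n) D (left i) + nbrsIn (K n) Big.ρ (left i)
            ≡⟨ cong₂ _+_ (cong₂ _∸_ (brushes-left-dirty Ei) (nbrs-left Ei)) (nbrs-fired-left i) ⟩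
          (base + x i) ∸ (base + nbrsIn (K a) E i) + nbrsIn (K a) Small.ρ i
            ≡⟨ cong (_+ nbrsIn (K a) Small.ρ i) ([m+n]∸[m+o]≡n∸o base (x i) _) ⟩
          x i ∸ nbrsIn (K a) E i + nbrsIn (K a) Small.ρ i
            ≡⟨ sym (Small.brushes-fired ρi) ⟩
          Small.ω′ i ∎

      mirrors-next : Mirrors Big.ω′ Big.D′ Small.ω′ Small.D′
      mirrors-next = record
        { dirty-left     = λ i → cong₂ (λ d f → d ∧ not f) (dirty-left i) (firing-left i)
        ; brushes-left   = next-brushes-left
        ; dirty-middle   = λ j → cong₂ (λ d f → d ∧ not f) (dirty-middle j) (idle-middle j)
        ; brushes-middle = λ j → next-brushes-idle (dirty-middle j) (idle-middle j) (brushes-middle j)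
        ; dirty-right    = λ k → cong₂ (λ d f → d ∧ not f) (dirty-right k) (idle-right k)
        ; brushes-right  = λ k → next-brushes-idle (dirty-right k) (idle-right k) (brushes-right k)
        }

    simulate : ∀ {P : Config a → DirtySet a → Set} {Q : Config n → DirtySet n → Set} {x E ω D} →
      Halts (K a) P x E →
      (∀ {x′ E′ ω′ D′} → P x′ E′ → Mirrors ω′ D′ x′ E′ → Halts (K n) Q ω′ D′) →
      Mirrors ω D x E → Halts (K n) Q ω D
    simulate (halt _ p)  continue r = continue p r
    simulate (next go h) continue r =
      next (MirrorStep.big-go r go) (simulate h continue (MirrorStep.mirrors-next r go))

    Unchanged : Config n → Config n → DirtySet n → Set
    Unchanged ω ω′ D′ = (∀ v → D′ v ≡ false) × (∀ v → ω′ v ≡ ω v)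

    -- Each right vertex has a − 1 dirty neighbours, so it sends out and gets back equally many brushes.
    module LastRound {ω : Config n} {D : DirtySet n}
                     (Dl : ∀ i → D (left i) ≡ false) (Dm : ∀ j → D (middle j) ≡ false)
                     (Dr : ∀ k → D (right k) ≡ true) (a≤ωr : ∀ k → a ≤ ω (right k)) where
      open Round (K n) ω D

      count-D : count D ≡ a
      count-D = trans (count-blocks D)
        (cong₂ _+_ (count-false Dl) (cong₂ _+_ (count-false Dm) (count-true Dr)))

      N<a : ∀ k → suc (nbrsIn (K n) D (right k)) ≡ a
      N<a k = trans (nbrsIn-K-∈ D (Dr k)) count-D

      N≤ωr : ∀ k → nbrsIn (K n) D (right k) ≤ ω (right k)
      N≤ωr k = ≤-trans (n≤1+n _) (≤-trans (≤-reflexive (N<a k)) (a≤ωr k))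

      ρr : ∀ k → ρ (right k) ≡ true
      ρr k = trans (firing-dirty (Dr k)) (≤ᵇ-true (N≤ωr k))

      count-ρ : count ρ ≡ a
      count-ρ = trans (count-blocks ρ) (cong₂ _+_ (count-false (firing-clean ∘ Dl))
                                        (cong₂ _+_ (count-false (firing-clean ∘ Dm)) (count-true ρr)))

      D′-clean : ∀ v → D′ v ≡ false
      D′-clean = blocks-elim _ (λ i → cong (_∧ not (ρ (left i))) (Dl i))
                               (λ j → cong (_∧ not (ρ (middle j))) (Dm j))
                               (λ k → cong₂ (λ d f → d ∧ not f) (Dr k) (ρr k))

      ω′r : ∀ k → ω′ (right k) ≡ ω (right k)
      ω′r k = begin
        ω′ (right k)
          ≡⟨ brushes-fired (ρr k) ⟩
        ω (right k) ∸ nbrsIn (K n) D (right k) + nbrsIn (K n) ρ (right k)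
          ≡⟨ cong (ω (right k) ∸ nbrsIn (K n) D (right k) +_)
                  (suc-injective (trans (nbrsIn-K-∈ ρ (ρr k)) (trans count-ρ (sym (N<a k))))) ⟩
        ω (right k) ∸ nbrsIn (K n) D (right k) + nbrsIn (K n) D (right k)
          ≡⟨ m∸n+n≡m (N≤ωr k) ⟩
        ω (right k) ∎
        where open ≡-Reasoning

      ω′≗ω : ∀ v → ω′ v ≡ ω v
      ω′≗ω = blocks-elim _ (brushes-clean ∘ Dl) (brushes-clean ∘ Dm) ω′r

      halts : Halts (K n) (Unchanged ω) ω D
      halts with anyFin ρ in any≡
      ... | true  = next any≡ (halt-clean (K n) D′-clean (D′-clean , ω′≗ω))
      ... | false = halt any≡ (blocks-elim _ Dl Dm right-clean , λ _ → refl)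
        where
        right-clean : ∀ k → D (right k) ≡ false
        right-clean k = contradiction (trans (sym (ρr k)) (anyFin-false ρ any≡ (right k))) λ ()

    Done : Config a → Config n → DirtySet n → Set
    Done x ω D = (∀ v → D v ≡ false) × ((∀ i → ω (left i) ≡ x i) ×
                 ((∀ j → ω (middle j) ≡ c) × (∀ k → ω (right k) ≡ Y k + base)))

    module MiddleRound {ω : Config n} {D : DirtySet n} {x : Config a} {E : DirtySet a}
                       (r : Mirrors ω D x E) (E-clean : ∀ i → E i ≡ false) where
      open Mirrors r
      open Round (K n) ω D

      count-E : count E ≡ 0
      count-E = count-false E-clean

      Dl : ∀ i → D (left i) ≡ false
      Dl i = trans (dirty-left i) (E-clean i)

      N≡ : ∀ {v} → D v ≡ true → nbrsIn (K n) D v ≡ c + a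
      N≡ Dv = suc-injective (trans (nbrsIn-K-∈ D Dv) (trans count-D (cong (_+ base) count-E)))

      ωm : ∀ j → ω (middle j) ≡ c + a
      ωm j = trans (sym (+-identityʳ _)) (trans (cong (ω (middle j) +_) (sym count-E)) (brushes-middle j))

      ωr : ∀ k → ω (right k) ≡ Y k + a
      ωr k = trans (sym (+-identityʳ _)) (trans (cong (ω (right k) +_) (sym count-E)) (brushes-right k))

      ρm : ∀ j → ρ (middle j) ≡ true
      ρm j = trans (firing-dirty (dirty-middle j))
                   (≤ᵇ-true (≤-reflexive (trans (N≡ (dirty-middle j)) (sym (ωm j)))))

      ρr : ∀ k → ρ (right k) ≡ false
      ρr k = trans (firing-dirty (dirty-right k))
                   (≤ᵇ-false (subst₂ _<_ (sym (ωr k)) (sym (N≡ (dirty-right k))) (+-monoˡ-< a (Y<c k))))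

      count-ρ : count ρ ≡ suc c
      count-ρ = trans (count-blocks ρ)
        (trans (cong₂ _+_ (count-false (firing-clean ∘ Dl)) (cong₂ _+_ (count-true ρm) (count-false ρr)))
               (+-identityʳ (suc c)))

      ω′m : ∀ j → ω′ (middle j) ≡ c
      ω′m j = begin
        ω′ (middle j)                                                ≡⟨ brushes-fired (ρm j) ⟩
        ω (middle j) ∸ nbrsIn (K n) D (middle j) + nbrsIn (K n) ρ (middle j)
          ≡⟨ cong₂ _+_ (cong₂ _∸_ (ωm j) (N≡ (dirty-middle j)))
                       (suc-injective (trans (nbrsIn-K-∈ ρ (ρm j)) count-ρ)) ⟩
        (c + a) ∸ (c + a) + c                                        ≡⟨ cong (_+ c) (n∸n≡0 (c + a)) ⟩
        c                                                            ∎
        where open ≡-Reasoning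

      ω′r : ∀ k → ω′ (right k) ≡ Y k + base
      ω′r k = begin
        ω′ (right k)                           ≡⟨ brushes-waiting (dirty-right k) (ρr k) ⟩
        ω (right k) + nbrsIn (K n) ρ (right k) ≡⟨ cong₂ _+_ (ωr k) (trans (nbrsIn-K-∉ ρ (ρr k)) count-ρ) ⟩
        Y k + a + suc c                        ≡⟨ +-assoc (Y k) a (suc c) ⟩
        Y k + (a + suc c)                      ≡⟨ cong (Y k +_) (+-comm a (suc c)) ⟩
        Y k + base                             ∎
        where open ≡-Reasoning

      halts : Halts (K n) (Done x) ω D
      halts = next (anyFin-intro ρ (ρm zero)) (Halts-map (K n) done
        (LastRound.halts (λ i → cong (_∧ not (ρ (left i))) (Dl i))
                         (λ j → cong₂ (λ d f → d ∧ not f) (dirty-middle j) (ρm j))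
                         (λ k → cong₂ (λ d f → d ∧ not f) (dirty-right k) (ρr k))
                         (λ k → subst (a ≤_) (sym (ω′r k))
                                      (≤-trans (m≤n+m a (suc c)) (m≤n+m base (Y k))))))
        where
        done : ∀ {ω″ D″} → Unchanged ω′ ω″ D″ → Done x ω″ D″
        done (D″-clean , ω″≗ω′) =
          D″-clean , ( (λ i → trans (ω″≗ω′ (left i))
                                     (trans (brushes-clean (Dl i)) (brushes-left-clean (E-clean i))))
                     , (λ j → trans (ω″≗ω′ (middle j)) (ω′m j))
                     , (λ k → trans (ω″≗ω′ (right k)) (ω′r k)))

  open Scheme S using () renaming (Inv to Inv₀; Inv⇒Cleans to Inv₀⇒Cleans; Inv-final to Inv₀-final;
                                   Inv⇒< to Inv₀⇒<; start to start₀; start-Inv to start₀-Inv)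

  record Layered (ω : Config n) : Set where
    field
      blocks    : Blocks n a (suc c)
      X Y       : Config a
      X-Inv     : Inv₀ X
      Y-Inv     : Inv₀ Y
      on-left   : ∀ i → ω (Blocks.left blocks i) ≡ X i + base
      on-middle : ∀ j → ω (Blocks.middle blocks j) ≡ c
      on-right  : ∀ k → ω (Blocks.right blocks k) ≡ Y k

    open Blocks blocks public

    Y<c : ∀ k → Y k < c
    Y<c k = ≤-trans (Inv₀⇒< Y-Inv k) a≤c

  Clean×Layered : Config n → DirtySet n → Set
  Clean×Layered ω D = (∀ v → D v ≡ false) × Layered ω

  Layered-halts : ∀ {ω} → Layered ω → Halts (K n) Clean×Layered ω allDirty
  Layered-halts {ω} L = simulate (final-Halts (K a) X) continue mirrors₀
    where
    open Layered L
    open Cleaning blocks Y Y<c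
    mirrors₀ : Mirrors ω allDirty X allDirty
    mirrors₀ = record
      { dirty-left     = λ _ → refl
      ; brushes-left   = λ i → trans (on-left i) (+-comm (X i) base)
      ; dirty-middle   = λ _ → refl
      ; brushes-middle = λ j → cong₂ _+_ (on-middle j) (count-true λ _ → refl)
      ; dirty-right    = λ _ → refl
      ; brushes-right  = λ k → cong₂ _+_ (on-right k) (count-true λ _ → refl)
      }
    continue : ∀ {x′ E′ ω′ D′} → ReachesRun (K a) a X allDirty x′ E′ → Mirrors ω′ D′ x′ E′ →
      Halts (K n) Clean×Layered ω′ D′
    continue {x′} (x′≗ , E′≗) r =
      Halts-map (K n) relayer (MiddleRound.halts r (λ i → trans (E′≗ i) (Inv₀⇒Cleans X-Inv i)))
      where
      relayer : ∀ {ω″ D″} → Done x′ ω″ D″ → Clean×Layered ω″ D″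
      relayer (D″-clean , ω″l , ω″m , ω″r) = D″-clean , record
        { blocks = mirror blocks ; X = Y ; Y = finalConfig (K a) X
        ; X-Inv = Y-Inv ; Y-Inv = Inv₀-final X-Inv
        ; on-left = ω″r ; on-middle = ω″m ; on-right = λ i → trans (ω″l i) (x′≗ i) }

  Layered-final : ∀ {ω} → Layered ω → Clean×Layered (finalConfig (K n) ω) (proj₂ (finalState (K n) ω))
  Layered-final L = Halts⇒final (K n) (Layered-halts L)

  Layered-< : ∀ {ω} → Layered ω → ∀ v → ω v < n
  Layered-< {ω} L v = subst (ω v <_) (sym size) (blocks-elim (λ v → ω v < a + (suc c + a)) l m r v)
    where
    open Layered L
    l : ∀ i → ω (left i) < a + base
    l i = subst (_< a + base) (sym (on-left i)) (+-monoˡ-< base (Inv₀⇒< X-Inv i))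
    m : ∀ j → ω (middle j) < a + base
    m j = subst (_< a + base) (sym (on-middle j)) (≤-trans (m≤m+n (suc c) a) (m≤n+m base a))
    r : ∀ k → ω (right k) < a + base
    r k = subst (_< a + base) (sym (on-right k)) (≤-trans (Inv₀⇒< Y-Inv k) (m≤m+n a base))

  module _ (B : Blocks n a (suc c)) where
    open Blocks B

    start : Config n
    start = glue (λ i → start₀ i + base) (λ _ → c) start₀

    tripled : Scheme n
    tripled = record
      { Inv = Layered
      ; Inv⇒Cleans = proj₁ ∘ Layered-final
      ; Inv-final = proj₂ ∘ Layered-final
      ; Inv⇒< = Layered-<
      ; start = start
      ; start-Inv = record
        { blocks = B ; X = start₀ ; Y = start₀ ; X-Inv = start₀-Inv ; Y-Inv = start₀-Inv
        ; on-left = glue-left _ _ _ ; on-middle = glue-middle _ _ _ ; on-right = glue-right _ _ _ }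
      }

    start-cost : totalBrushes start ≡ 2 * totalBrushes start₀ + (a * base + suc c * c)
    start-cost = begin
      sumFin start
        ≡⟨ sumFin-blocks start ⟩
      sumFin (start ∘ left) + (sumFin (start ∘ middle) + sumFin (start ∘ right))
        ≡⟨ cong₂ _+_ (trans (sumFin-cong (glue-left _ _ _)) (sumFin-+ start₀ (λ _ → base)))
                     (cong₂ _+_ (sumFin-cong (glue-middle _ _ _)) (sumFin-cong (glue-right _ _ _))) ⟩
      sumFin start₀ + sumFin {a} (λ _ → base) + (sumFin {suc c} (λ _ → c) + sumFin start₀)
        ≡⟨ cong₂ (λ p q → sumFin start₀ + p + (q + sumFin start₀))
                 (sumFin-const a base) (sumFin-const (suc c) c) ⟩
      sumFin start₀ + a * base + (suc c * c + sumFin start₀)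
        ≡⟨ regroup (sumFin start₀) (a * base) (suc c * c) ⟩
      2 * sumFin start₀ + (a * base + suc c * c) ∎
      where
      open ≡-Reasoning
      regroup : ∀ t p q → t + p + (q + t) ≡ 2 * t + (p + q)
      regroup = solve-∀

initialScheme : ∀ n₀ → Σ (Scheme n₀) λ S → totalBrushes (Scheme.start S) ≤ n₀ * n₀
initialScheme zero    = scheme₀ , z≤n
initialScheme (suc m) = Tripling.tripled z≤n scheme₀ B ,
  ≤-trans (≤-reflexive (Tripling.start-cost z≤n scheme₀ B)) (*-monoʳ-≤ (suc m) (n≤1+n m))
  where
  B : Blocks (suc m) 0 (suc m)
  B = blocksOf 0 (suc m) (sym (+-identityʳ (suc m)))

-- With P = 9 ^ i and Q = 2 ^ i the quadratic terms match exactly; the identities exhibit the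
-- remaining linear and constant terms as polynomials with non-negative coefficients.
cost-bound : ∀ a e T P Q k → e ≤ 2 →
  T * (63 * P) ≤ (27 * P + Q) * (a * a) + (2 + k) * a * (63 * P) →
  (2 * T + (a * (suc (a + e) + a) + suc (a + e) * (a + e))) * (63 * (9 * P))
    ≤ (27 * (9 * P) + 2 * Q) * ((3 * a + suc e) * (3 * a + suc e)) + (2 + k) * (3 * a + suc e) * (63 * (9 * P))
cost-bound a e T P Q k e≤2 T≤ = begin
  (2 * T + R e) * (63 * (9 * P))           ≡⟨ expand T P (R e) ⟩
  18 * (T * (63 * P)) + 567 * P * R e      ≤⟨ +-monoˡ-≤ (567 * P * R e) (*-monoʳ-≤ 18 T≤) ⟩
  18 * H + 567 * P * R e                   ≤⟨ slack e e≤2 ⟩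
  _                                        ∎
  where
  open ≤-Reasoning
  R : ℕ → ℕ
  R e = a * (suc (a + e) + a) + suc (a + e) * (a + e)
  H : ℕ
  H = (27 * P + Q) * (a * a) + (2 + k) * a * (63 * P)
  expand : ∀ T P R → (2 * T + R) * (63 * (9 * P)) ≡ 18 * (T * (63 * P)) + 567 * P * R
  expand = solve-∀
  id₀ : ∀ a P Q k →
    (27 * (9 * P) + 2 * Q) * ((3 * a + 1) * (3 * a + 1)) + (2 + k) * (3 * a + 1) * (63 * (9 * P))
      ≡ 18 * ((27 * P + Q) * (a * a) + (2 + k) * a * (63 * P))
        + 567 * P * (a * (suc (a + 0) + a) + suc (a + 0) * (a + 0))
        + (1458 * P * a + 1377 * P + 12 * Q * a + 2 * Q + 567 * P * a * k + 567 * P * k)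
  id₀ = solve-∀
  id₁ : ∀ a P Q k →
    (27 * (9 * P) + 2 * Q) * ((3 * a + 2) * (3 * a + 2)) + (2 + k) * (3 * a + 2) * (63 * (9 * P))
      ≡ 18 * ((27 * P + Q) * (a * a) + (2 + k) * a * (63 * P))
        + 567 * P * (a * (suc (a + 1) + a) + suc (a + 1) * (a + 1))
        + (1215 * P * a + 2106 * P + 24 * Q * a + 8 * Q + 567 * P * a * k + 1134 * P * k)
  id₁ = solve-∀
  id₂ : ∀ a P Q k →
    (27 * (9 * P) + 2 * Q) * ((3 * a + 3) * (3 * a + 3)) + (2 + k) * (3 * a + 3) * (63 * (9 * P))
      ≡ 18 * ((27 * P + Q) * (a * a) + (2 + k) * a * (63 * P))
        + 567 * P * (a * (suc (a + 2) + a) + suc (a + 2) * (a + 2))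
        + (972 * P * a + 2187 * P + 36 * Q * a + 18 * Q + 567 * P * a * k + 1701 * P * k)
  id₂ = solve-∀
  slack : ∀ e → e ≤ 2 → 18 * H + 567 * P * R e
    ≤ (27 * (9 * P) + 2 * Q) * ((3 * a + suc e) * (3 * a + suc e)) + (2 + k) * (3 * a + suc e) * (63 * (9 * P))
  slack 0 _ = ≤-trans (m≤m+n _ _) (≤-reflexive (sym (id₀ a P Q k)))
  slack 1 _ = ≤-trans (m≤m+n _ _) (≤-reflexive (sym (id₁ a P Q k)))
  slack 2 _ = ≤-trans (m≤m+n _ _) (≤-reflexive (sym (id₂ a P Q k)))
  slack (suc (suc (suc _))) (s≤s (s≤s ()))

tripleScheme : ∀ {a} dv → 1 ≤ dv → dv ≤ 3 → ∀ P Q k (S : Scheme a) →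
  totalBrushes (Scheme.start S) * (63 * P) ≤ (27 * P + Q) * (a * a) + (2 + k) * a * (63 * P) →
  Σ (Scheme (3 * a + dv)) λ S′ → totalBrushes (Scheme.start S′) * (63 * (9 * P))
    ≤ (27 * (9 * P) + 2 * Q) * ((3 * a + dv) * (3 * a + dv)) + (2 + k) * (3 * a + dv) * (63 * (9 * P))
tripleScheme {a} (suc e) _ (s≤s e≤2) P Q k S bound =
  Tripling.tripled a≤c S B ,
  subst (λ t → t * (63 * (9 * P)) ≤ _) (sym (Tripling.start-cost a≤c S B))
        (cost-bound a e (totalBrushes (Scheme.start S)) P Q k e≤2 bound)
  where
  a≤c : a ≤ a + e
  a≤c = m≤m+n a e
  size-eq : ∀ a e → 3 * a + suc e ≡ a + (suc (a + e) + a)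
  size-eq = solve-∀
  B : Blocks (3 * a + suc e) a (suc (a + e))
  B = blocksOf a (suc (a + e)) (size-eq a e)

module _ (n₀ : ℕ) (d : ℕ → ℕ) (d∈[1,3] : ∀ i → 1 ≤ d i × d i ≤ 3) where

  Bound : ℕ → ℕ → Set
  Bound i T = T * (63 * 9 ^ i)
    ≤ (27 * 9 ^ i + 2 ^ i) * (nSeq n₀ d i * nSeq n₀ d i) + (2 + n₀) * nSeq n₀ d i * (63 * 9 ^ i)

  schemes : ∀ i → Σ (Scheme (nSeq n₀ d i)) λ S → Bound i (totalBrushes (Scheme.start S))
  schemes zero = let S , T≤ = initialScheme n₀ in S , (begin
    totalBrushes (Scheme.start S) * 63 ≤⟨ *-monoˡ-≤ 63 T≤ ⟩
    n₀ * n₀ * 63                       ≤⟨ *-monoˡ-≤ 63 (*-monoˡ-≤ n₀ (m≤n+m n₀ 2)) ⟩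
    (2 + n₀) * n₀ * 63                 ≤⟨ m≤n+m _ _ ⟩
    _                                  ∎)
    where open ≤-Reasoning
  schemes (suc i) = let S , bound = schemes i; 1≤d , d≤3 = d∈[1,3] i in
    tripleScheme (d i) 1≤d d≤3 (9 ^ i) (2 ^ i) n₀ S bound

mainTheorem1 : (n₀ : ℕ) (d : ℕ → ℕ) → (∀ i → 1 ≤ d i × d i ≤ 3) →
    Σ ℕ λ C → ∀ i →
      Σ (Config (nSeq n₀ d i)) λ ω₀ →
        ContinuallyCleans (K (nSeq n₀ d i)) ω₀ ×
        totalBrushes ω₀ * (63 * 9 ^ i)
          ≤ (27 * 9 ^ i + 2 ^ i) * (nSeq n₀ d i * nSeq n₀ d i)
            + C * nSeq n₀ d i * (63 * 9 ^ i)
mainTheorem1 n₀ d d∈[1,3] = 2 + n₀ , λ i →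
  let S , bound = schemes n₀ d d∈[1,3] i
  in Scheme.start S , Scheme.start-continually S , bound
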